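{- For every string $\beta$ over $A$ with strictly increasing letters and all closed terms $P,Q\in\mathcal{SP}_{A,\beta}$: $\mathrm{EqSFEL}\vdash P=Q$ if and only if $\mathit{sfe}_\beta(P)=\mathit{sfe}_\beta(Q)$. (That is, the logic $\mathrm{SFEL}$ is axiomatised by $\mathrm{EqSFEL}$.)
   Context: Let $A$ be a countable set of atoms, totally ordered as $a_1<a_2<\cdots$. $\mathcal{SP}_A$: closed terms generated by $P::=\mathsf T\mid\mathsf F\mid a\mid \neg P\mid P\mathbin{\wedge_\bullet}P\mid P\mathbin{\vee_\bullet}P$ ($a\in A$); $\alpha(P)$ is the set of atoms occurring in $P$. For a string $\beta$ with strictly increasing letters, $\mathcal{SP}_{A,\beta}=\{P\in\mathcal{SP}_A\mid \alpha(P)\subseteq\text{letters of }\beta\}$, and $\widetilde{\mathsf F}_\epsilon=\mathsf F$, $\widetilde{\mathsf F}_{a\rho}=a\mathbin{\wedge_\bullet}\widetilde{\mathsf F}_\rho$. $\mathcal T_A$: $\mathsf T,\mathsf F\in\mathcal T_A$ and $(X\trianglelefteq a\trianglerighteq Y)\in\mathcal T_A$. Leaf replacement $X[\mathsf T\mapsto Y,\mathsf F\mapsto Z]$ replaces leaves $\mathsf T$ by $Y$ and $\mathsf F$ by $Z$; omitted replacements are identities. $\mathit{fe}(\mathsf T)=\mathsf T$, $\mathit{fe}(\mathsf F)=\mathsf F$, $\mathit{fe}(a)=\mathsf T\trianglelefteq a\trianglerighteq\mathsf F$, $\mathit{fe}(\neg P)=\mathit{fe}(P)[\mathsf T\mapsto\mathsf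 F,\mathsf F\mapsto\mathsf T]$, $\mathit{fe}(P\mathbin{\wedge_\bullet}Q)=\mathit{fe}(P)[\mathsf T\mapsto\mathit{fe}(Q),\mathsf F\mapsto\mathit{fe}(Q)[\mathsf T\mapsto\mathsf F]]$, $\mathit{fe}(P\mathbin{\vee_\bullet}Q)=\mathit{fe}(P)[\mathsf T\mapsto\mathit{fe}(Q)[\mathsf F\mapsto\mathsf T],\mathsf F\mapsto\mathit{fe}(Q)]$. $L_a(B)=R_a(B)=B$ for leaves; $L_a(X\trianglelefteq b\trianglerighteq Y)=L_a(X)$ if $b=a$, else $L_a(X)\trianglelefteq b\trianglerighteq L_a(Y)$; $R_a(X\trianglelefteq b\trianglerighteq Y)=R_a(Y)$ if $b=a$, else $R_a(X)\trianglelefteq b\trianglerighteq R_a(Y)$; $m(B)=B$, $m(X\trianglelefteq a\trianglerighteq Y)=m(L_a(X))\trianglelefteq a\trianglerighteq m(R_a(Y))$; $\mathit{mfe}(P)=m(\mathit{fe}(P))$; $\mathit{sfe}_\beta(P)=\mathit{mfe}(\widetilde{\mathsf F}_\beta\mathbin{\vee_\bullet}P)$ for $P\in\mathcal{SP}_{A,\beta}$. $\mathrm{EqFFEL}$: $\mathsf F=\neg\mathsf T$; $x\mathbin{\vee_\bullet}y=\neg(\neg x\mathbin{\wedge_\bullet}\neg y)$; $\neg\neg x=x$; $(x\mathbin{\wedge_\bullet}y)\mathbin{\wedge_\bullet}z=x\mathbin{\wedge_\bullet}(y\mathbin{\wedge_\bullet}z)$; $\mathsf T\mathbin{\wedge_\bullet}x=x$;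 $x\mathbin{\wedge_\bullet}\mathsf T=x$; $x\mathbin{\wedge_\bullet}\mathsf F=\mathsf F\mathbin{\wedge_\bullet}x$; $\neg x\mathbin{\wedge_\bullet}\mathsf F=x\mathbin{\wedge_\bullet}\mathsf F$; $(x\mathbin{\wedge_\bullet}\mathsf F)\mathbin{\vee_\bullet}y=(x\mathbin{\vee_\bullet}\mathsf T)\mathbin{\wedge_\bullet}y$; $x\mathbin{\vee_\bullet}(y\mathbin{\wedge_\bullet}\mathsf F)=x\mathbin{\wedge_\bullet}(y\mathbin{\vee_\bullet}\mathsf T)$. $\mathrm{EqSFEL}=\mathrm{EqFFEL}\cup\{(x\mathbin{\vee_\bullet}y)\mathbin{\wedge_\bullet}z=(\neg x\mathbin{\wedge_\bullet}(y\mathbin{\wedge_\bullet}z))\mathbin{\vee_\bullet}(x\mathbin{\wedge_\bullet}z),\ x\mathbin{\wedge_\bullet}y=y\mathbin{\wedge_\bullet}x,\ x\mathbin{\wedge_\bullet}\mathsf F=\mathsf F\}$. $\vdash$ is derivability in equational logic. -}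

module Defs where

open import Data.Nat using (ℕ; zero; suc; _<_; _⊔_)
open import Data.Nat.Properties using (_≟_)
open import Data.Empty using (⊥; ⊥-elim)
open import Data.List using (List; []; _∷_; _++_; foldr)
open import Relation.Nullary using (yes; no)

-- Atoms: A = ℕ, with a_i = i and the usual (total) order.

Atom : Set
Atom = ℕ

-- Terms over atoms, with variables from V (variables are needed for
-- the equational axioms; closed terms are terms over the empty set).

infixr 6 _∧•_
infixr 5 _∨•_

data Tm (V : Set) : Set where
  var  : V → Tm V
  𝐓 𝐅  : Tm V
  atom : Atom → Tm V
  ¬•_  : Tm V → Tm V
  _∧•_ : Tm V → Tm V → Tm V
  _∨•_ : Tm V → Tm V → Tm V

SP : Set
SP = Tm ⊥

_[_] : ∀ {V W : Set} → Tm V → (V → Tm W) → Tm W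
var x     [ σ ] = σ x
𝐓         [ σ ] = 𝐓
𝐅         [ σ ] = 𝐅
atom a    [ σ ] = atom a
(¬• P)    [ σ ] = ¬• (P [ σ ])
(P ∧• Q)  [ σ ] = (P [ σ ]) ∧• (Q [ σ ])
(P ∨• Q)  [ σ ] = (P [ σ ]) ∨• (Q [ σ ])

emb : SP → Tm ℕ
emb P = P [ (λ ()) ]

atoms : ∀ {V : Set} → Tm V → List Atom
atoms (var x)   = []
atoms 𝐓         = []
atoms 𝐅         = []
atoms (atom a)  = a ∷ []
atoms (¬• P)    = atoms P
atoms (P ∧• Q)  = atoms P ++ atoms Q
atoms (P ∨• Q)  = atoms P ++ atoms Q

F̃ : List Atom → SP
F̃ = foldr (λ a ρ → atom a ∧• ρ) 𝐅

private
  x y z : Tm ℕ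
  x = var 0
  y = var 1
  z = var 2

data EqSFEL : Tm ℕ → Tm ℕ → Set where
  -- EqFFEL
  F1  : EqSFEL 𝐅 (¬• 𝐓)
  F2  : EqSFEL (x ∨• y) (¬• ((¬• x) ∧• (¬• y)))
  F3  : EqSFEL (¬• (¬• x)) x
  F4  : EqSFEL ((x ∧• y) ∧• z) (x ∧• (y ∧• z))
  F5  : EqSFEL (𝐓 ∧• x) x
  F6  : EqSFEL (x ∧• 𝐓) x
  F7  : EqSFEL (x ∧• 𝐅) (𝐅 ∧• x)
  F8  : EqSFEL ((¬• x) ∧• 𝐅) (x ∧• 𝐅)
  F9  : EqSFEL ((x ∧• 𝐅) ∨• y) ((x ∨• 𝐓) ∧• y)
  F10 : EqSFEL (x ∨• (y ∧• 𝐅)) (x ∧• (y ∨• 𝐓))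
  -- additional SFEL axioms
  S1  : EqSFEL ((x ∨• y) ∧• z) (((¬• x) ∧• (y ∧• z)) ∨• (x ∧• z))
  S2  : EqSFEL (x ∧• y) (y ∧• x)
  S3  : EqSFEL (x ∧• 𝐅) 𝐅

infix 4 EqSFEL⊢_≈_
data EqSFEL⊢_≈_ : Tm ℕ → Tm ℕ → Set where
  ax    : ∀ {l r} → EqSFEL l r → (σ : ℕ → Tm ℕ) → EqSFEL⊢ l [ σ ] ≈ r [ σ ]
  refl  : ∀ {t} → EqSFEL⊢ t ≈ t
  sym   : ∀ {t u} → EqSFEL⊢ t ≈ u → EqSFEL⊢ u ≈ t
  trans : ∀ {t u v} → EqSFEL⊢ t ≈ u → EqSFEL⊢ u ≈ v → EqSFEL⊢ t ≈ v
  cong¬ : ∀ {t u} → EqSFEL⊢ t ≈ u → EqSFEL⊢ ¬• t ≈ ¬• u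
  cong∧ : ∀ {t t' u u'} → EqSFEL⊢ t ≈ t' → EqSFEL⊢ u ≈ u' → EqSFEL⊢ t ∧• u ≈ t' ∧• u'
  cong∨ : ∀ {t t' u u'} → EqSFEL⊢ t ≈ t' → EqSFEL⊢ u ≈ u' → EqSFEL⊢ t ∨• u ≈ t' ∨• u'

-- Evaluation trees T_A:  node X a Y  stands for  X ⊴ a ⊵ Y.

data Tree : Set where
  T F  : Tree
  node : Tree → Atom → Tree → Tree

_[T↦_,F↦_] : Tree → Tree → Tree → Tree
T [T↦ Y ,F↦ Z ] = Y
F [T↦ Y ,F↦ Z ] = Z
node X a X' [T↦ Y ,F↦ Z ] = node (X [T↦ Y ,F↦ Z ]) a (X' [T↦ Y ,F↦ Z ])

fe : SP → Tree
fe (var ())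
fe 𝐓        = T
fe 𝐅        = F
fe (atom a) = node T a F
fe (¬• P)   = fe P [T↦ F ,F↦ T ]
fe (P ∧• Q) = fe P [T↦ fe Q ,F↦ (fe Q [T↦ F ,F↦ F ]) ]
fe (P ∨• Q) = fe P [T↦ (fe Q [T↦ T ,F↦ T ]) ,F↦ fe Q ]

L R : Atom → Tree → Tree
L a T = T
L a F = F
L a (node X b Y) with b ≟ a
... | yes _ = L a X
... | no  _ = node (L a X) b (L a Y)
R a T = T
R a F = F
R a (node X b Y) with b ≟ a
... | yes _ = R a Y
... | no  _ = node (R a X) b (R a Y)

depth : Tree → ℕ
depth T = zero
depth F = zero
depth (node X _ Y) = suc (depth X ⊔ depth Y)

-- m, defined with fuel; since depth (L a X) ≤ depth X and
-- depth (R a Y) ≤ depth Y, fuel = depth is always sufficient, so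
-- m X = mF (depth X) X agrees with the paper's recursive definition.
mF : ℕ → Tree → Tree
mF zero X = X
mF (suc n) T = T
mF (suc n) F = F
mF (suc n) (node X a Y) = node (mF n (L a X)) a (mF n (R a Y))

m : Tree → Tree
m X = mF (depth X) X

mfe : SP → Tree
mfe P = m (fe P)

sfe : List Atom → SP → Tree
sfe β P = mfe (F̃ β ∨• P)

-- EqSFEL is sound for the two-valued reading of the connectives.  On the tree side,
-- fe (F̃_β ∨• P) is the complete binary tree over β carrying a copy of fe P at every leaf;
-- m resolves each later occurrence of an atom by the value chosen for it higher up the path,
-- and since the letters of β are distinct this yields exactly the truth table of P over β.
-- Hence derivably equal terms have equal sfe.  Conversely, EqSFEL proves enough Boolean
-- algebra to show every term equal to the if-then-else term read off its truth table tree,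
-- so terms with equal sfe are derivably equal.
module Submission where

open import Defs
open import Data.Nat using (ℕ; zero; suc; _<_; _≤_; z≤n; s≤s)
open import Data.Nat.Properties using (_≟_; ≟-diag; >⇒≢; <-trans; m≤m⊔n; ≤-trans)
open import Data.Bool using (Bool; true; false; not; _∧_; _∨_)
open import Data.Bool.Properties
  using (not-involutive; ∧-assoc; ∧-comm; ∧-identityʳ; ∧-zeroʳ; ∨-zeroʳ; ∨-identityʳ)
open import Data.Maybe using (Maybe; just; nothing; fromMaybe)
open import Data.List using (List; []; _∷_; length)
open import Data.List.Relation.Unary.All using (All; []; _∷_)
import Data.List.Relation.Unary.All as All
open import Data.List.Relation.Unary.All.Properties using (++⁻ˡ; ++⁻ʳ)
open import Data.List.Relation.Unary.AllPairs using (AllPairs; []; _∷_)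
open import Data.List.Relation.Unary.Linked using (Linked)
open import Data.List.Relation.Unary.Linked.Properties using (Linked⇒AllPairs)
open import Data.List.Relation.Unary.Any using (here; there)
open import Data.List.Membership.Propositional using (_∈_)
open import Data.Product using (∃; _,_)
open import Data.Sum using (_⊎_; inj₁; inj₂)
open import Data.Empty using (⊥-elim)
open import Relation.Nullary using (yes; no)
open import Relation.Binary.Bundles using (Setoid)
open import Relation.Binary.PropositionalEquality as ≡ using (_≡_; _≢_; ≢-sym; cong; cong₂)
open import Function.Bundles using (_⇔_; mk⇔)
open import Function.Base using (_∘_)

infix 4 _≈_
_≈_ : Tm ℕ → Tm ℕ → Set
_≈_ = EqSFEL⊢_≈_

≈-setoid : Setoid _ _
≈-setoid = record
  { Carrier = Tm ℕ ; _≈_ = _≈_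
  ; isEquivalence = record { refl = refl ; sym = sym ; trans = trans } }

open import Relation.Binary.Reasoning.Setoid ≈-setoid

≡⇒≈ : ∀ {t u} → t ≡ u → t ≈ u
≡⇒≈ ≡.refl = refl

subst₃ : Tm ℕ → Tm ℕ → Tm ℕ → ℕ → Tm ℕ
subst₃ a b c 0 = a
subst₃ a b c 1 = b
subst₃ a b c 2 = c
subst₃ a b c (suc (suc (suc n))) = var n

𝐅≈¬𝐓 : 𝐅 ≈ ¬• 𝐓
𝐅≈¬𝐓 = ax F1 (subst₃ 𝐓 𝐓 𝐓)

∨≈¬∧¬ : ∀ a b → a ∨• b ≈ ¬• (¬• a ∧• ¬• b)
∨≈¬∧¬ a b = ax F2 (subst₃ a b 𝐓)

¬-involutive : ∀ a → ¬• ¬• a ≈ a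
¬-involutive a = ax F3 (subst₃ a 𝐓 𝐓)

∧-assoc• : ∀ a b c → (a ∧• b) ∧• c ≈ a ∧• (b ∧• c)
∧-assoc• a b c = ax F4 (subst₃ a b c)

∧-identityˡ• : ∀ a → 𝐓 ∧• a ≈ a
∧-identityˡ• a = ax F5 (subst₃ a 𝐓 𝐓)

∧-identityʳ• : ∀ a → a ∧• 𝐓 ≈ a
∧-identityʳ• a = ax F6 (subst₃ a 𝐓 𝐓)

∨-∧-expand : ∀ a b c → (a ∨• b) ∧• c ≈ (¬• a ∧• (b ∧• c)) ∨• (a ∧• c)
∨-∧-expand a b c = ax S1 (subst₃ a b c)

∧-comm• : ∀ a b → a ∧• b ≈ b ∧• a
∧-comm• a b = ax S2 (subst₃ a b 𝐓)

∧-zeroʳ• : ∀ a → a ∧• 𝐅 ≈ 𝐅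
∧-zeroʳ• a = ax S3 (subst₃ a 𝐓 𝐓)

∧-zeroˡ• : ∀ a → 𝐅 ∧• a ≈ 𝐅
∧-zeroˡ• a = trans (∧-comm• 𝐅 a) (∧-zeroʳ• a)

¬𝐓≈𝐅 : ¬• 𝐓 ≈ 𝐅
¬𝐓≈𝐅 = sym 𝐅≈¬𝐓

¬𝐅≈𝐓 : ¬• 𝐅 ≈ 𝐓
¬𝐅≈𝐓 = trans (cong¬ 𝐅≈¬𝐓) (¬-involutive 𝐓)

∨-comm• : ∀ a b → a ∨• b ≈ b ∨• a
∨-comm• a b = begin
  a ∨• b                ≈⟨ ∨≈¬∧¬ a b ⟩
  ¬• (¬• a ∧• ¬• b)     ≈⟨ cong¬ (∧-comm• (¬• a) (¬• b)) ⟩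
  ¬• (¬• b ∧• ¬• a)     ≈⟨ ∨≈¬∧¬ b a ⟨
  b ∨• a                ∎

∨-assoc• : ∀ a b c → (a ∨• b) ∨• c ≈ a ∨• (b ∨• c)
∨-assoc• a b c = begin
  (a ∨• b) ∨• c                          ≈⟨ ∨≈¬∧¬ _ _ ⟩
  ¬• (¬• (a ∨• b) ∧• ¬• c)               ≈⟨ cong¬ (cong∧ ¬∨ refl) ⟩
  ¬• ((¬• a ∧• ¬• b) ∧• ¬• c)            ≈⟨ cong¬ (∧-assoc• _ _ _) ⟩
  ¬• (¬• a ∧• (¬• b ∧• ¬• c))            ≈⟨ cong¬ (cong∧ refl ¬∨) ⟨
  ¬• (¬• a ∧• ¬• (b ∨• c))               ≈⟨ ∨≈¬∧¬ _ _ ⟨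
  a ∨• (b ∨• c)                          ∎
  where
  ¬∨ : ∀ {x y} → ¬• (x ∨• y) ≈ ¬• x ∧• ¬• y
  ¬∨ {x} {y} = trans (cong¬ (∨≈¬∧¬ x y)) (¬-involutive _)

∨-identityʳ• : ∀ a → a ∨• 𝐅 ≈ a
∨-identityʳ• a = begin
  a ∨• 𝐅               ≈⟨ ∨≈¬∧¬ a 𝐅 ⟩
  ¬• (¬• a ∧• ¬• 𝐅)    ≈⟨ cong¬ (cong∧ refl ¬𝐅≈𝐓) ⟩
  ¬• (¬• a ∧• 𝐓)       ≈⟨ cong¬ (∧-identityʳ• _) ⟩
  ¬• ¬• a              ≈⟨ ¬-involutive a ⟩
  a                    ∎

∨-identityˡ• : ∀ a → 𝐅 ∨• a ≈ a
∨-identityˡ• a = trans (∨-comm• 𝐅 a) (∨-identityʳ• a)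

∨-zeroʳ• : ∀ a → a ∨• 𝐓 ≈ 𝐓
∨-zeroʳ• a = begin
  a ∨• 𝐓               ≈⟨ ∨≈¬∧¬ a 𝐓 ⟩
  ¬• (¬• a ∧• ¬• 𝐓)    ≈⟨ cong¬ (cong∧ refl ¬𝐓≈𝐅) ⟩
  ¬• (¬• a ∧• 𝐅)       ≈⟨ cong¬ (∧-zeroʳ• _) ⟩
  ¬• 𝐅                 ≈⟨ ¬𝐅≈𝐓 ⟩
  𝐓                    ∎

¬-∧≈∨-¬ : ∀ a b → ¬• (a ∧• b) ≈ ¬• a ∨• ¬• b
¬-∧≈∨-¬ a b = sym (trans (∨≈¬∧¬ _ _) (cong¬ (cong∧ (¬-involutive a) (¬-involutive b))))

∨-inverseˡ• : ∀ a → ¬• a ∨• a ≈ 𝐓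
∨-inverseˡ• a = begin
  ¬• a ∨• a                             ≈⟨ cong∨ (∧-identityʳ• _) (∧-identityʳ• a) ⟨
  (¬• a ∧• 𝐓) ∨• (a ∧• 𝐓)               ≈⟨ cong∨ (cong∧ refl (∧-identityʳ• 𝐓)) refl ⟨
  (¬• a ∧• (𝐓 ∧• 𝐓)) ∨• (a ∧• 𝐓)        ≈⟨ ∨-∧-expand a 𝐓 𝐓 ⟨
  (a ∨• 𝐓) ∧• 𝐓                         ≈⟨ ∧-identityʳ• _ ⟩
  a ∨• 𝐓                                ≈⟨ ∨-zeroʳ• a ⟩
  𝐓                                     ∎

∧-inverseʳ• : ∀ a → a ∧• ¬• a ≈ 𝐅
∧-inverseʳ• a = begin
  a ∧• ¬• a                ≈⟨ ¬-involutive _ ⟨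
  ¬• ¬• (a ∧• ¬• a)        ≈⟨ cong¬ (¬-∧≈∨-¬ _ _) ⟩
  ¬• (¬• a ∨• ¬• ¬• a)     ≈⟨ cong¬ (cong∨ refl (¬-involutive a)) ⟩
  ¬• (¬• a ∨• a)           ≈⟨ cong¬ (∨-inverseˡ• a) ⟩
  ¬• 𝐓                     ≈⟨ ¬𝐓≈𝐅 ⟩
  𝐅                        ∎

∧-inverseˡ• : ∀ a → ¬• a ∧• a ≈ 𝐅
∧-inverseˡ• a = trans (∧-comm• _ _) (∧-inverseʳ• a)

∨-idem• : ∀ a → a ∨• a ≈ a
∨-idem• a = begin
  a ∨• a                           ≈⟨ ∧-identityʳ• _ ⟨
  (a ∨• a) ∧• 𝐓                    ≈⟨ ∨-∧-expand a a 𝐓 ⟩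
  (¬• a ∧• (a ∧• 𝐓)) ∨• (a ∧• 𝐓)   ≈⟨ cong∨ (cong∧ refl (∧-identityʳ• a)) (∧-identityʳ• a) ⟩
  (¬• a ∧• a) ∨• a                 ≈⟨ cong∨ (∧-inverseˡ• a) refl ⟩
  𝐅 ∨• a                           ≈⟨ ∨-identityˡ• a ⟩
  a                                ∎

∧-idem• : ∀ a → a ∧• a ≈ a
∧-idem• a = begin
  a ∧• a               ≈⟨ ¬-involutive _ ⟨
  ¬• ¬• (a ∧• a)       ≈⟨ cong¬ (¬-∧≈∨-¬ a a) ⟩
  ¬• (¬• a ∨• ¬• a)    ≈⟨ cong¬ (∨-idem• _) ⟩
  ¬• ¬• a              ≈⟨ ¬-involutive a ⟩
  a                    ∎

shannon : ∀ c z → z ≈ (c ∧• z) ∨• (¬• c ∧• z)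
shannon c z = begin
  z                                        ≈⟨ ∧-identityˡ• z ⟨
  𝐓 ∧• z                                   ≈⟨ cong∧ (∨-inverseˡ• c) refl ⟨
  (¬• c ∨• c) ∧• z                         ≈⟨ ∨-∧-expand _ _ _ ⟩
  (¬• ¬• c ∧• (c ∧• z)) ∨• (¬• c ∧• z)     ≈⟨ cong∨ (cong∧ (¬-involutive c) refl) refl ⟩
  (c ∧• (c ∧• z)) ∨• (¬• c ∧• z)           ≈⟨ cong∨ (∧-assoc• _ _ _) refl ⟨
  ((c ∧• c) ∧• z) ∨• (¬• c ∧• z)           ≈⟨ cong∨ (cong∧ (∧-idem• c) refl) refl ⟩
  (c ∧• z) ∨• (¬• c ∧• z)                  ∎

∨-absorbs-∧ : ∀ a b → a ∨• (a ∧• b) ≈ a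
∨-absorbs-∧ a b = begin
  a ∨• (a ∧• b)                               ≈⟨ cong∨ (shannon b a) refl ⟩
  ((b ∧• a) ∨• (¬• b ∧• a)) ∨• (a ∧• b)       ≈⟨ cong∨ (∨-comm• _ _) refl ⟩
  ((¬• b ∧• a) ∨• (b ∧• a)) ∨• (a ∧• b)       ≈⟨ ∨-assoc• _ _ _ ⟩
  (¬• b ∧• a) ∨• ((b ∧• a) ∨• (a ∧• b))       ≈⟨ cong∨ refl (cong∨ refl (∧-comm• a b)) ⟩
  (¬• b ∧• a) ∨• ((b ∧• a) ∨• (b ∧• a))       ≈⟨ cong∨ refl (∨-idem• _) ⟩
  (¬• b ∧• a) ∨• (b ∧• a)                     ≈⟨ ∨-comm• _ _ ⟩
  (b ∧• a) ∨• (¬• b ∧• a)                     ≈⟨ shannon b a ⟨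
  a                                           ∎

∧-distribˡ-∨• : ∀ a b c → a ∧• (b ∨• c) ≈ (a ∧• b) ∨• (a ∧• c)
∧-distribˡ-∨• a b c = begin
  a ∧• (b ∨• c)                                             ≈⟨ ∧-comm• _ _ ⟩
  (b ∨• c) ∧• a                                             ≈⟨ ∨-∧-expand _ _ _ ⟩
  (¬• b ∧• (c ∧• a)) ∨• (b ∧• a)                            ≈⟨ ∨-comm• _ _ ⟩
  (b ∧• a) ∨• (¬• b ∧• (c ∧• a))                            ≈⟨ cong∨ (∨-absorbs-∧ _ c) refl ⟨
  ((b ∧• a) ∨• ((b ∧• a) ∧• c)) ∨• (¬• b ∧• (c ∧• a))       ≈⟨ ∨-assoc• _ _ _ ⟩
  (b ∧• a) ∨• (((b ∧• a) ∧• c) ∨• (¬• b ∧• (c ∧• a)))       ≈⟨ cong∨ refl (cong∨ bac≈bca refl) ⟩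
  (b ∧• a) ∨• ((b ∧• (c ∧• a)) ∨• (¬• b ∧• (c ∧• a)))       ≈⟨ cong∨ refl (shannon b _) ⟨
  (b ∧• a) ∨• (c ∧• a)                                      ≈⟨ cong∨ (∧-comm• b a) (∧-comm• c a) ⟩
  (a ∧• b) ∨• (a ∧• c)                                      ∎
  where
  bac≈bca : (b ∧• a) ∧• c ≈ b ∧• (c ∧• a)
  bac≈bca = trans (∧-assoc• _ _ _) (cong∧ refl (∧-comm• a c))

ite : Tm ℕ → Tm ℕ → Tm ℕ → Tm ℕ
ite c X Y = (c ∧• X) ∨• (¬• c ∧• Y)

ite-unique : ∀ {c A X Y} → c ∧• A ≈ c ∧• X → ¬• c ∧• A ≈ ¬• c ∧• Y → A ≈ ite c X Y
ite-unique {c} {A} p q = trans (shannon c A) (cong∨ p q)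

ite-idem : ∀ c z → ite c z z ≈ z
ite-idem c z = sym (shannon c z)

ite-𝐓-𝐅 : ∀ c → ite c 𝐓 𝐅 ≈ c
ite-𝐓-𝐅 c = trans (cong∨ (∧-identityʳ• c) (∧-zeroʳ• _)) (∨-identityʳ• c)

∧-idem-guard : ∀ g X → g ∧• (g ∧• X) ≈ g ∧• X
∧-idem-guard g X = trans (sym (∧-assoc• g g X)) (cong∧ (∧-idem• g) refl)

∧-disjoint-guard : ∀ {g h} X → g ∧• h ≈ 𝐅 → g ∧• (h ∧• X) ≈ 𝐅
∧-disjoint-guard {g} {h} X gh≈𝐅 = trans (sym (∧-assoc• g h X)) (trans (cong∧ gh≈𝐅 refl) (∧-zeroˡ• X))

ite-then : ∀ c X Y → c ∧• ite c X Y ≈ c ∧• X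
ite-then c X Y = begin
  c ∧• ite c X Y                           ≈⟨ ∧-distribˡ-∨• _ _ _ ⟩
  (c ∧• (c ∧• X)) ∨• (c ∧• (¬• c ∧• Y))    ≈⟨ cong∨ (∧-idem-guard c X) (∧-disjoint-guard Y (∧-inverseʳ• c)) ⟩
  (c ∧• X) ∨• 𝐅                            ≈⟨ ∨-identityʳ• _ ⟩
  c ∧• X                                   ∎

ite-else : ∀ c X Y → ¬• c ∧• ite c X Y ≈ ¬• c ∧• Y
ite-else c X Y = begin
  ¬• c ∧• ite c X Y                               ≈⟨ ∧-distribˡ-∨• _ _ _ ⟩
  (¬• c ∧• (c ∧• X)) ∨• (¬• c ∧• (¬• c ∧• Y))     ≈⟨ cong∨ (∧-disjoint-guard X (∧-inverseˡ• c)) (∧-idem-guard (¬• c) Y) ⟩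
  𝐅 ∨• (¬• c ∧• Y)                                ≈⟨ ∨-identityˡ• _ ⟩
  ¬• c ∧• Y                                       ∎

¬-guard : ∀ {g A X} → g ∧• A ≈ g ∧• X → g ∧• ¬• A ≈ g ∧• ¬• X
¬-guard {g} {A} {X} gA≈gX = begin
  g ∧• ¬• A              ≈⟨ guard-¬ A ⟨
  g ∧• ¬• (g ∧• A)       ≈⟨ cong∧ refl (cong¬ gA≈gX) ⟩
  g ∧• ¬• (g ∧• X)       ≈⟨ guard-¬ X ⟩
  g ∧• ¬• X              ∎
  where
  guard-¬ : ∀ Z → g ∧• ¬• (g ∧• Z) ≈ g ∧• ¬• Z
  guard-¬ Z = begin
    g ∧• ¬• (g ∧• Z)              ≈⟨ cong∧ refl (¬-∧≈∨-¬ _ _) ⟩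
    g ∧• (¬• g ∨• ¬• Z)           ≈⟨ ∧-distribˡ-∨• _ _ _ ⟩
    (g ∧• ¬• g) ∨• (g ∧• ¬• Z)    ≈⟨ cong∨ (∧-inverseʳ• g) refl ⟩
    𝐅 ∨• (g ∧• ¬• Z)              ≈⟨ ∨-identityˡ• _ ⟩
    g ∧• ¬• Z                     ∎

∧-guard : ∀ {g A B X Y} → g ∧• A ≈ g ∧• X → g ∧• B ≈ g ∧• Y → g ∧• (A ∧• B) ≈ g ∧• (X ∧• Y)
∧-guard {g} {A} {B} {X} {Y} gA≈gX gB≈gY = begin
  g ∧• (A ∧• B)     ≈⟨ ∧-assoc• _ _ _ ⟨
  (g ∧• A) ∧• B     ≈⟨ cong∧ (trans gA≈gX (∧-comm• g X)) refl ⟩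
  (X ∧• g) ∧• B     ≈⟨ ∧-assoc• _ _ _ ⟩
  X ∧• (g ∧• B)     ≈⟨ cong∧ refl gB≈gY ⟩
  X ∧• (g ∧• Y)     ≈⟨ ∧-assoc• _ _ _ ⟨
  (X ∧• g) ∧• Y     ≈⟨ cong∧ (∧-comm• X g) refl ⟩
  (g ∧• X) ∧• Y     ≈⟨ ∧-assoc• _ _ _ ⟩
  g ∧• (X ∧• Y)     ∎

¬-ite : ∀ c X Y → ¬• ite c X Y ≈ ite c (¬• X) (¬• Y)
¬-ite c X Y = ite-unique (¬-guard (ite-then c X Y)) (¬-guard (ite-else c X Y))

ite-∧-ite : ∀ c X Y X′ Y′ → ite c X Y ∧• ite c X′ Y′ ≈ ite c (X ∧• X′) (Y ∧• Y′)
ite-∧-ite c X Y X′ Y′ =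
  ite-unique (∧-guard (ite-then c X Y) (ite-then c X′ Y′)) (∧-guard (ite-else c X Y) (ite-else c X′ Y′))

eval : ∀ {V : Set} → (V → Bool) → (Atom → Bool) → Tm V → Bool
eval ρ v (var x)  = ρ x
eval ρ v 𝐓        = true
eval ρ v 𝐅        = false
eval ρ v (atom a) = v a
eval ρ v (¬• P)   = not (eval ρ v P)
eval ρ v (P ∧• Q) = eval ρ v P ∧ eval ρ v Q
eval ρ v (P ∨• Q) = eval ρ v P ∨ eval ρ v Q

⟦_⟧ : SP → (Atom → Bool) → Bool
⟦ P ⟧ v = eval (λ ()) v P

eval-subst : ∀ {V W : Set} (t : Tm V) (σ : V → Tm W) ρ v → eval ρ v (t [ σ ]) ≡ eval (λ x → eval ρ v (σ x)) v t
eval-subst (var x)  σ ρ v = ≡.refl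
eval-subst 𝐓        σ ρ v = ≡.refl
eval-subst 𝐅        σ ρ v = ≡.refl
eval-subst (atom a) σ ρ v = ≡.refl
eval-subst (¬• t)   σ ρ v = cong not (eval-subst t σ ρ v)
eval-subst (t ∧• u) σ ρ v = cong₂ _∧_ (eval-subst t σ ρ v) (eval-subst u σ ρ v)
eval-subst (t ∨• u) σ ρ v = cong₂ _∨_ (eval-subst t σ ρ v) (eval-subst u σ ρ v)

eval-emb : ∀ P ρ v → eval ρ v (emb P) ≡ ⟦ P ⟧ v
eval-emb (var ())
eval-emb 𝐓        ρ v = ≡.refl
eval-emb 𝐅        ρ v = ≡.refl
eval-emb (atom a) ρ v = ≡.refl
eval-emb (¬• P)   ρ v = cong not (eval-emb P ρ v)
eval-emb (P ∧• Q) ρ v = cong₂ _∧_ (eval-emb P ρ v) (eval-emb Q ρ v)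
eval-emb (P ∨• Q) ρ v = cong₂ _∨_ (eval-emb P ρ v) (eval-emb Q ρ v)

∨≡not-not∧not : ∀ a b → a ∨ b ≡ not (not a ∧ not b)
∨≡not-not∧not true  b = ≡.refl
∨≡not-not∧not false b = ≡.sym (not-involutive b)

eval-axiom : ∀ {l r} → EqSFEL l r → ∀ ρ v → eval ρ v l ≡ eval ρ v r
eval-axiom F1 ρ v = ≡.refl
eval-axiom F2 ρ v = ∨≡not-not∧not (ρ 0) (ρ 1)
eval-axiom F3 ρ v = not-involutive (ρ 0)
eval-axiom F4 ρ v = ∧-assoc (ρ 0) (ρ 1) (ρ 2)
eval-axiom F5 ρ v = ≡.refl
eval-axiom F6 ρ v = ∧-identityʳ (ρ 0)
eval-axiom F7 ρ v = ∧-zeroʳ (ρ 0)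
eval-axiom F8 ρ v = ≡.trans (∧-zeroʳ (not (ρ 0))) (≡.sym (∧-zeroʳ (ρ 0)))
eval-axiom F9 ρ v rewrite ∧-zeroʳ (ρ 0) | ∨-zeroʳ (ρ 0) = ≡.refl
eval-axiom F10 ρ v rewrite ∧-zeroʳ (ρ 1) | ∨-zeroʳ (ρ 1) =
  ≡.trans (∨-identityʳ (ρ 0)) (≡.sym (∧-identityʳ (ρ 0)))
eval-axiom S1 ρ v with ρ 0
... | true  = ≡.refl
... | false = ≡.sym (∨-identityʳ _)
eval-axiom S2 ρ v = ∧-comm (ρ 0) (ρ 1)
eval-axiom S3 ρ v = ∧-zeroʳ (ρ 0)

sound : ∀ {t u} → t ≈ u → ∀ ρ v → eval ρ v t ≡ eval ρ v u
sound (ax {l} {r} e σ) ρ v =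
  ≡.trans (eval-subst l σ ρ v) (≡.trans (eval-axiom e _ v) (≡.sym (eval-subst r σ ρ v)))
sound refl          ρ v = ≡.refl
sound (sym d)       ρ v = ≡.sym (sound d ρ v)
sound (trans d e)   ρ v = ≡.trans (sound d ρ v) (sound e ρ v)
sound (cong¬ d)     ρ v = cong not (sound d ρ v)
sound (cong∧ d e)   ρ v = cong₂ _∧_ (sound d ρ v) (sound e ρ v)
sound (cong∨ d e)   ρ v = cong₂ _∨_ (sound d ρ v) (sound e ρ v)

sound-closed : ∀ {P Q} → emb P ≈ emb Q → ∀ v → ⟦ P ⟧ v ≡ ⟦ Q ⟧ v
sound-closed {P} {Q} d v =
  ≡.trans (≡.sym (eval-emb P ρ v)) (≡.trans (sound d ρ v) (eval-emb Q ρ v))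
  where
  ρ : ℕ → Bool
  ρ _ = true

PVal : Set
PVal = Atom → Maybe Bool

empty : PVal
empty _ = nothing

_[_≔_] : PVal → Atom → Bool → PVal
(u [ a ≔ t ]) c with c ≟ a
... | yes _ = just t
... | no  _ = u c

update-≡ : ∀ u a t → (u [ a ≔ t ]) a ≡ just t
update-≡ u a t rewrite ≟-diag (≡.refl {x = a}) = ≡.refl

update-≢ : ∀ u a t {c} → c ≢ a → (u [ a ≔ t ]) c ≡ u c
update-≢ u a t c≢a rewrite ≡.≢-≟-identity _≟_ c≢a = ≡.refl

Decided : PVal → Atom → Set
Decided u a = ∃ λ t → u a ≡ just t

-- Undecided atoms read as false; the tables below consult it only once every relevant atom is decided.
total : PVal → Atom → Bool
total u a = fromMaybe false (u a)

truth : SP → PVal → Bool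
truth P u = ⟦ P ⟧ (total u)

leaf : Bool → Tree
leaf true  = T
leaf false = F

table : List Atom → PVal → (PVal → Bool) → Tree
table []      u f = leaf (f u)
table (a ∷ β) u f = node (table β (u [ a ≔ true ]) f) a (table β (u [ a ≔ false ]) f)

table-cong : ∀ β u {f g} → (∀ u′ → f u′ ≡ g u′) → table β u f ≡ table β u g
table-cong []      u f≗g = cong leaf (f≗g u)
table-cong (a ∷ β) u f≗g = cong₂ (λ X Y → node X a Y) (table-cong β _ f≗g) (table-cong β _ f≗g)

full : List Atom → Tree → Tree
full []      Y = Y
full (a ∷ β) Y = node (full β Y) a (full β Y)

prune : PVal → Tree → Tree
prune′ : Maybe Bool → PVal → Tree → Atom → Tree → Tree
prune u T            = T
prune u F            = F
prune u (node X b Y) = prune′ (u b) u X b Y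
prune′ (just true)  u X b Y = prune u X
prune′ (just false) u X b Y = prune u Y
prune′ nothing      u X b Y = node (prune u X) b (prune u Y)

prune-empty : ∀ X → prune empty X ≡ X
prune-empty T            = ≡.refl
prune-empty F            = ≡.refl
prune-empty (node X a Y) = cong₂ (λ X′ Y′ → node X′ a Y′) (prune-empty X) (prune-empty Y)

prune-replace : ∀ u X Y Z → prune u (X [T↦ Y ,F↦ Z ]) ≡ prune u X [T↦ prune u Y ,F↦ prune u Z ]
prune-replace u T Y Z = ≡.refl
prune-replace u F Y Z = ≡.refl
prune-replace u (node X b X′) Y Z with u b
... | just true  = prune-replace u X Y Z
... | just false = prune-replace u X′ Y Z
... | nothing    = cong₂ (λ X″ Y″ → node X″ b Y″) (prune-replace u X Y Z) (prune-replace u X′ Y Z)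

leaf-not : ∀ s → leaf s [T↦ F ,F↦ T ] ≡ leaf (not s)
leaf-not true  = ≡.refl
leaf-not false = ≡.refl

leaf-and : ∀ s t → leaf s [T↦ leaf t ,F↦ leaf t [T↦ F ,F↦ F ] ] ≡ leaf (s ∧ t)
leaf-and true  t     = ≡.refl
leaf-and false true  = ≡.refl
leaf-and false false = ≡.refl

leaf-or : ∀ s t → leaf s [T↦ leaf t [T↦ T ,F↦ T ] ,F↦ leaf t ] ≡ leaf (s ∨ t)
leaf-or true  true  = ≡.refl
leaf-or true  false = ≡.refl
leaf-or false t     = ≡.refl

prune-fe : ∀ u P → All (Decided u) (atoms P) → prune u (fe P) ≡ leaf (truth P u)
prune-fe u (var ())
prune-fe u 𝐓 _ = ≡.refl
prune-fe u 𝐅 _ = ≡.refl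
prune-fe u (atom a) ((t , ua≡t) ∷ []) with u a
prune-fe u (atom a) ((true  , ≡.refl) ∷ []) | just .true  = ≡.refl
prune-fe u (atom a) ((false , ≡.refl) ∷ []) | just .false = ≡.refl
prune-fe u (¬• P) P↓
  rewrite prune-replace u (fe P) F T | prune-fe u P P↓ = leaf-not (truth P u)
prune-fe u (P ∧• Q) PQ↓
  rewrite prune-replace u (fe P) (fe Q) (fe Q [T↦ F ,F↦ F ]) | prune-replace u (fe Q) F F
        | prune-fe u P (++⁻ˡ (atoms P) PQ↓) | prune-fe u Q (++⁻ʳ (atoms P) PQ↓)
  = leaf-and (truth P u) (truth Q u)
prune-fe u (P ∨• Q) PQ↓
  rewrite prune-replace u (fe P) (fe Q [T↦ T ,F↦ T ]) (fe Q) | prune-replace u (fe Q) T T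
        | prune-fe u P (++⁻ˡ (atoms P) PQ↓) | prune-fe u Q (++⁻ʳ (atoms P) PQ↓)
  = leaf-or (truth P u) (truth Q u)

L-prune : ∀ u a X → u a ≡ nothing → L a (prune u X) ≡ prune (u [ a ≔ true ]) X
L-prune u a T ua≡· = ≡.refl
L-prune u a F ua≡· = ≡.refl
L-prune u a (node X b Y) ua≡· with b ≟ a
L-prune u a (node X .a Y) ua≡· | yes ≡.refl rewrite ua≡· | ≟-diag (≡.refl {x = a}) = L-prune u a X ua≡·
L-prune u a (node X b Y) ua≡· | no b≢a with u b
... | just true  = L-prune u a X ua≡·
... | just false = L-prune u a Y ua≡·
... | nothing rewrite ≡.≢-≟-identity _≟_ b≢a =
  cong₂ (λ X′ Y′ → node X′ b Y′) (L-prune u a X ua≡·) (L-prune u a Y ua≡·)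

R-prune : ∀ u a X → u a ≡ nothing → R a (prune u X) ≡ prune (u [ a ≔ false ]) X
R-prune u a T ua≡· = ≡.refl
R-prune u a F ua≡· = ≡.refl
R-prune u a (node X b Y) ua≡· with b ≟ a
R-prune u a (node X .a Y) ua≡· | yes ≡.refl rewrite ua≡· | ≟-diag (≡.refl {x = a}) = R-prune u a Y ua≡·
R-prune u a (node X b Y) ua≡· | no b≢a with u b
... | just true  = R-prune u a X ua≡·
... | just false = R-prune u a Y ua≡·
... | nothing rewrite ≡.≢-≟-identity _≟_ b≢a =
  cong₂ (λ X′ Y′ → node X′ b Y′) (R-prune u a X ua≡·) (R-prune u a Y ua≡·)

L-full : ∀ a β Y → All (_≢ a) β → L a (full β Y) ≡ full β (L a Y)
L-full a []      Y []            = ≡.refl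
L-full a (b ∷ β) Y (b≢a ∷ β≢a) rewrite ≡.≢-≟-identity _≟_ b≢a | L-full a β Y β≢a = ≡.refl

R-full : ∀ a β Y → All (_≢ a) β → R a (full β Y) ≡ full β (R a Y)
R-full a []      Y []            = ≡.refl
R-full a (b ∷ β) Y (b≢a ∷ β≢a) rewrite ≡.≢-≟-identity _≟_ b≢a | R-full a β Y β≢a = ≡.refl

full-replace : ∀ β Z Y V → full β Z [T↦ Y ,F↦ V ] ≡ full β (Z [T↦ Y ,F↦ V ])
full-replace []      Z Y V = ≡.refl
full-replace (a ∷ β) Z Y V rewrite full-replace β Z Y V = ≡.refl

fe-F̃ : ∀ β → fe (F̃ β) ≡ full β F
fe-F̃ []      = ≡.refl
fe-F̃ (a ∷ β) rewrite fe-F̃ β | full-replace β F F F = ≡.refl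

fe-F̃-∨ : ∀ β P → fe (F̃ β ∨• P) ≡ full β (fe P)
fe-F̃-∨ β P rewrite fe-F̃ β = full-replace β F (fe P [T↦ T ,F↦ T ]) (fe P)

length≤depth-full : ∀ β Y → length β ≤ depth (full β Y)
length≤depth-full []      Y = z≤n
length≤depth-full (a ∷ β) Y = s≤s (≤-trans (length≤depth-full β Y) (m≤m⊔n _ _))

mF-leaf : ∀ n t → mF n (leaf t) ≡ leaf t
mF-leaf zero    t     = ≡.refl
mF-leaf (suc n) true  = ≡.refl
mF-leaf (suc n) false = ≡.refl

Undecided : PVal → List Atom → Set
Undecided u β = All (λ b → u b ≡ nothing) β

Covers : List Atom → PVal → SP → Set
Covers β u P = All (λ c → c ∈ β ⊎ Decided u c) (atoms P)

undecided-update : ∀ u a t β → All (_≢ a) β → Undecided u β → Undecided (u [ a ≔ t ]) β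
undecided-update u a t []      []            []              = []
undecided-update u a t (b ∷ β) (b≢a ∷ β≢a) (ub≡· ∷ β-open) =
  ≡.trans (update-≢ u a t b≢a) ub≡· ∷ undecided-update u a t β β≢a β-open

covers-update : ∀ u a t β P → Covers (a ∷ β) u P → Covers β (u [ a ≔ t ]) P
covers-update u a t β P = All.map step
  where
  step : ∀ {c} → c ∈ a ∷ β ⊎ Decided u c → c ∈ β ⊎ Decided (u [ a ≔ t ]) c
  step (inj₁ (here ≡.refl)) = inj₂ (t , update-≡ u a t)
  step (inj₁ (there c∈β))   = inj₁ c∈β
  step {c} (inj₂ (s , uc≡s)) with c ≟ a
  ... | yes _ = inj₂ (t , ≡.refl)
  ... | no  _ = inj₂ (s , uc≡s)

-- On pruned trees L a and R a act as fixing a to true and to false, so m evaluates fe P along each path.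
mF-full-prune : ∀ β n u P → AllPairs _<_ β → length β ≤ n → Undecided u β → Covers β u P →
                mF n (full β (prune u (fe P))) ≡ table β u (truth P)
mF-full-prune [] n u P [] _ [] cover =
  ≡.trans (cong (mF n) (prune-fe u P (All.map decided cover))) (mF-leaf n (truth P u))
  where
  decided : ∀ {c} → c ∈ [] ⊎ Decided u c → Decided u c
  decided (inj₂ d) = d
mF-full-prune (a ∷ β) (suc n) u P (a<β ∷ β↑) (s≤s β≤n) (ua≡· ∷ β-open) cover =
  cong₂ (λ X Y → node X a Y)
    (≡.trans (cong (mF n) (≡.trans (L-full a β _ a∉β) (cong (full β) (L-prune u a (fe P) ua≡·)))) (branch true))
    (≡.trans (cong (mF n) (≡.trans (R-full a β _ a∉β) (cong (full β) (R-prune u a (fe P) ua≡·)))) (branch false))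
  where
  a∉β : All (_≢ a) β
  a∉β = All.map >⇒≢ a<β
  branch : ∀ t → mF n (full β (prune (u [ a ≔ t ]) (fe P))) ≡ table β (u [ a ≔ t ]) (truth P)
  branch t = mF-full-prune β n (u [ a ≔ t ]) P β↑ β≤n
               (undecided-update u a t β a∉β β-open) (covers-update u a t β P cover)

sfe≡table : ∀ β P → AllPairs _<_ β → All (_∈ β) (atoms P) → sfe β P ≡ table β empty (truth P)
sfe≡table β P β↑ P⊆β rewrite fe-F̃-∨ β P =
  ≡.trans (cong (λ X → mF (depth (full β (fe P))) (full β X)) (≡.sym (prune-empty (fe P))))
    (mF-full-prune β _ empty P β↑ (length≤depth-full β _) (All.tabulate (λ _ → ≡.refl)) (All.map inj₁ P⊆β))

toTerm : Tree → Tm ℕ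
toTerm T            = 𝐓
toTerm F            = 𝐅
toTerm (node X a Y) = ite (atom a) (toTerm X) (toTerm Y)

toTerm-leaf-not : ∀ s → ¬• toTerm (leaf s) ≈ toTerm (leaf (not s))
toTerm-leaf-not true  = ¬𝐓≈𝐅
toTerm-leaf-not false = ¬𝐅≈𝐓

toTerm-leaf-and : ∀ s t → toTerm (leaf s) ∧• toTerm (leaf t) ≈ toTerm (leaf (s ∧ t))
toTerm-leaf-and true  t = ∧-identityˡ• _
toTerm-leaf-and false t = ∧-zeroˡ• _

nf-not : ∀ β u f → ¬• toTerm (table β u f) ≈ toTerm (table β u (λ u′ → not (f u′)))
nf-not []      u f = toTerm-leaf-not (f u)
nf-not (a ∷ β) u f = trans (¬-ite _ _ _) (cong∨ (cong∧ refl (nf-not β _ f)) (cong∧ refl (nf-not β _ f)))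

nf-and : ∀ β u f g → toTerm (table β u f) ∧• toTerm (table β u g) ≈ toTerm (table β u (λ u′ → f u′ ∧ g u′))
nf-and []      u f g = toTerm-leaf-and (f u) (g u)
nf-and (a ∷ β) u f g =
  trans (ite-∧-ite _ _ _ _ _) (cong∨ (cong∧ refl (nf-and β _ f g)) (cong∧ refl (nf-and β _ f g)))

nf-or : ∀ β u f g → toTerm (table β u f) ∨• toTerm (table β u g) ≈ toTerm (table β u (λ u′ → f u′ ∨ g u′))
nf-or β u f g = begin
  toTerm (table β u f) ∨• toTerm (table β u g)                             ≈⟨ ∨≈¬∧¬ _ _ ⟩
  ¬• (¬• toTerm (table β u f) ∧• ¬• toTerm (table β u g))                  ≈⟨ cong¬ (cong∧ (nf-not β u f) (nf-not β u g)) ⟩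
  ¬• (toTerm (table β u (not ∘ f)) ∧• toTerm (table β u (not ∘ g)))        ≈⟨ cong¬ (nf-and β u _ _) ⟩
  ¬• toTerm (table β u (λ u′ → not (f u′) ∧ not (g u′)))                   ≈⟨ nf-not β u _ ⟩
  toTerm (table β u (λ u′ → not (not (f u′) ∧ not (g u′))))                ≈⟨ ≡⇒≈ (cong toTerm (table-cong β u (λ u′ → ∨≡not-not∧not (f u′) (g u′)))) ⟨
  toTerm (table β u (λ u′ → f u′ ∨ g u′))                                  ∎

nf-const : ∀ β u t → toTerm (table β u (λ _ → t)) ≈ toTerm (leaf t)
nf-const []      u t = refl
nf-const (a ∷ β) u t = trans (cong∨ (cong∧ refl (nf-const β _ t)) (cong∧ refl (nf-const β _ t))) (ite-idem _ _)

table-decided : ∀ a β u {t} → All (_≢ a) β → u a ≡ just t → table β u (λ u′ → total u′ a) ≡ table β u (λ _ → t)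
table-decided a []      u []          ua≡t = cong (leaf ∘ fromMaybe false) ua≡t
table-decided a (b ∷ β) u (b≢a ∷ β≢a) ua≡t = cong₂ (λ X Y → node X b Y) (branch true) (branch false)
  where
  branch : ∀ s → table β (u [ b ≔ s ]) (λ u′ → total u′ a) ≡ table β (u [ b ≔ s ]) _
  branch s = table-decided a β (u [ b ≔ s ]) β≢a (≡.trans (update-≢ u b s (≢-sym b≢a)) ua≡t)

nf-atom : ∀ β u a → AllPairs _<_ β → a ∈ β → toTerm (table β u (λ u′ → total u′ a)) ≈ atom a
nf-atom (b ∷ β) u a (b<β ∷ β↑) a∈bβ with b ≟ a
nf-atom (b ∷ β) u .b (b<β ∷ β↑) _ | yes ≡.refl =
  trans (cong∨ (cong∧ refl (branch true)) (cong∧ refl (branch false))) (ite-𝐓-𝐅 _)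
  where
  branch : ∀ t → toTerm (table β (u [ b ≔ t ]) (λ u′ → total u′ b)) ≈ toTerm (leaf t)
  branch t = trans (≡⇒≈ (cong toTerm (table-decided b β _ (All.map >⇒≢ b<β) (update-≡ u b t)))) (nf-const β _ t)
nf-atom (b ∷ β) u a (b<β ∷ β↑) (here a≡b)   | no b≢a = ⊥-elim (b≢a (≡.sym a≡b))
nf-atom (b ∷ β) u a (b<β ∷ β↑) (there a∈β) | no b≢a =
  trans (cong∨ (cong∧ refl (nf-atom β _ a β↑ a∈β)) (cong∧ refl (nf-atom β _ a β↑ a∈β))) (ite-idem _ _)

nf : ∀ β P → AllPairs _<_ β → All (_∈ β) (atoms P) → emb P ≈ toTerm (table β empty (truth P))
nf β (var ())
nf β 𝐓        β↑ _          = sym (nf-const β empty true)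
nf β 𝐅        β↑ _          = sym (nf-const β empty false)
nf β (atom a) β↑ (a∈β ∷ []) = sym (nf-atom β empty a β↑ a∈β)
nf β (¬• P)   β↑ P⊆β        = trans (cong¬ (nf β P β↑ P⊆β)) (nf-not β empty (truth P))
nf β (P ∧• Q) β↑ PQ⊆β       =
  trans (cong∧ (nf β P β↑ (++⁻ˡ (atoms P) PQ⊆β)) (nf β Q β↑ (++⁻ʳ (atoms P) PQ⊆β))) (nf-and β empty _ _)
nf β (P ∨• Q) β↑ PQ⊆β       =
  trans (cong∨ (nf β P β↑ (++⁻ˡ (atoms P) PQ⊆β)) (nf β Q β↑ (++⁻ʳ (atoms P) PQ⊆β))) (nf-or β empty _ _)

theorem7p4 : (β : List Atom) → Linked _<_ β →
    (P Q : SP) → All (_∈ β) (atoms P) → All (_∈ β) (atoms Q) →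
    (EqSFEL⊢ emb P ≈ emb Q) ⇔ (sfe β P ≡ sfe β Q)
theorem7p4 β β↑ P Q P⊆β Q⊆β = mk⇔ soundness completeness
  where
  β⇈ : AllPairs _<_ β
  β⇈ = Linked⇒AllPairs <-trans β↑
  tableP : sfe β P ≡ table β empty (truth P)
  tableP = sfe≡table β P β⇈ P⊆β
  tableQ : sfe β Q ≡ table β empty (truth Q)
  tableQ = sfe≡table β Q β⇈ Q⊆β
  soundness : EqSFEL⊢ emb P ≈ emb Q → sfe β P ≡ sfe β Q
  soundness P≈Q = ≡.trans tableP (≡.trans (table-cong β empty (sound-closed {P} {Q} P≈Q ∘ total)) (≡.sym tableQ))
  completeness : sfe β P ≡ sfe β Q → EqSFEL⊢ emb P ≈ emb Q
  completeness P≡Q = begin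
    emb P                                ≈⟨ nf β P β⇈ P⊆β ⟩
    toTerm (table β empty (truth P))     ≡⟨ cong toTerm (≡.trans (≡.sym tableP) (≡.trans P≡Q tableQ)) ⟩
    toTerm (table β empty (truth Q))     ≈⟨ nf β Q β⇈ Q⊆β ⟨
    emb Q                                ∎
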